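{- Let $k \geq 3$, let $m_1,m_2 \in \mathbb{N}$, let $G = G_1+G_2$ where $G_i$ is a copy of $K_{1,m_i}$, with $G_1$ having bipartition $\{w_0\}$, $A$ and $G_2$ having bipartition $\{u_0\}$, $B$, and let $L$ be a $k$-assignment for $G$. Suppose the $\epsilon$-greedy process is run on $G$ and $L$, producing $G_\epsilon$, $L_\epsilon$, $g_\epsilon$. If no color appears in at least $\rho$ of the lists $L_\epsilon(v)$, $v \in V(G_\epsilon)-\{w_0,u_0\}$, where $\rho = \lceil |V(G)|/k\rceil$, then $G$ is equitably $L$-colorable.
   Context: A list assignment $L$ for a graph $G$ assigns to each vertex $v$ a set $L(v)$ of colors; it is a $k$-assignment if $|L(v)|=k$ for all $v$; its palette is $\mathcal{L}=\bigcup_{v} L(v)$. A proper $L$-coloring is a proper coloring $f$ with $f(v)\in L(v)$ for all $v$; a partial $L$-coloring is such a map defined on a subset of $V(G)$ that is proper on the induced subgraph of that subset. If $L$ is a $k$-assignment, an equitable $L$-coloring of $G$ is a proper $L$-coloring in which each color of $\mathcal{L}$ appears on at most $\lceil |V(G)|/k \rceil$ vertices. The $\epsilon$-greedy process (with $G,L,A,B,w_0,u_0,\rho$ as in the claim, $k\ge 3$): for $t = 1,2,\dots,k-2$ in turn, if there is a color $c_t \in \mathcal{L}-\{c_1,\dots,c_{t-1}\}$ lying in at least $\rho$ of the lists $L(v)$ with $v \in (A\cup B) - \bigcup_{i<t} C_i$, choose such a color $c_t$ and an arbitrary set $C_t$ of exactly $\rho$ such vertices, and continue; otherwise stop. If $s$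 steps were completed ($0 \le s \le k-2$), the output is $G_\epsilon = G - \bigcup_{i=1}^s C_i$, the list assignment $L_\epsilon(v) = L(v) - \{c_1,\dots,c_s\}$ for $v \in V(G_\epsilon)$, and the partial $L$-coloring $g_\epsilon:\bigcup_{i=1}^s C_i \to \{c_1,\dots,c_s\}$ with $g_\epsilon(v)=c_i$ for $v\in C_i$. The claim holds for any run of the process (any choices made). -}

module Defs where

open import Data.Nat using (ℕ; zero; suc; _+_; _∸_; _≤_)
open import Data.Nat.DivMod using (_/_)
open import Data.Fin using (Fin)
open import Data.List using (List; []; _∷_; length; map; concatMap)
open import Data.List.Membership.Propositional using (_∈_; _∉_)
open import Data.List.Relation.Unary.All using (All)
open import Data.List.Relation.Unary.Unique.Propositional using (Unique)
open import Data.Product using (Σ; ∃; _×_; _,_; proj₁; proj₂)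
open import Data.Sum using (_⊎_)
open import Relation.Binary.PropositionalEquality using (_≡_; _≢_)
open import Relation.Nullary using (¬_)

-- Ceiling division ⌈ n / k ⌉ (the value for k = 0 is irrelevant; we set 0).
ceilDiv : ℕ → ℕ → ℕ
ceilDiv n zero    = 0
ceilDiv n (suc k) = (n + k) / suc k

Color : Set
Color = ℕ

-- Vertices of G = G₁ + G₂, G₁ = K_{1,m₁} (center w₀, leaves A = {a i}),
-- G₂ = K_{1,m₂} (center u₀, leaves B = {b j}); disjoint union.
data Vtx (m₁ m₂ : ℕ) : Set where
  w₀ : Vtx m₁ m₂
  u₀ : Vtx m₁ m₂
  a  : Fin m₁ → Vtx m₁ m₂
  b  : Fin m₂ → Vtx m₁ m₂

data Adj {m₁ m₂ : ℕ} : Vtx m₁ m₂ → Vtx m₁ m₂ → Set where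
  w-a : (i : Fin m₁) → Adj w₀ (a i)
  a-w : (i : Fin m₁) → Adj (a i) w₀
  u-b : (j : Fin m₂) → Adj u₀ (b j)
  b-u : (j : Fin m₂) → Adj (b j) u₀

data InAB {m₁ m₂ : ℕ} : Vtx m₁ m₂ → Set where
  inA : (i : Fin m₁) → InAB (a i)
  inB : (j : Fin m₂) → InAB (b j)

numV : ℕ → ℕ → ℕ
numV m₁ m₂ = m₁ + m₂ + 2

-- A list assignment: each vertex gets a finite set of colors (a duplicate-free list).
ListAssignment : ℕ → ℕ → Set
ListAssignment m₁ m₂ = Vtx m₁ m₂ → List Color

IsKAssignment : {m₁ m₂ : ℕ} → ℕ → ListAssignment m₁ m₂ → Set
IsKAssignment k L = ∀ v → Unique (L v) × length (L v) ≡ k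

InPalette : {m₁ m₂ : ℕ} → ListAssignment m₁ m₂ → Color → Set
InPalette L c = ∃ λ v → c ∈ L v

AtLeast : {m₁ m₂ : ℕ} → ℕ → (Vtx m₁ m₂ → Set) → Set
AtLeast {m₁} {m₂} r P =
  Σ (List (Vtx m₁ m₂)) λ vs → Unique vs × length vs ≡ r × All P vs

AtMost : {m₁ m₂ : ℕ} → ℕ → (Vtx m₁ m₂ → Set) → Set
AtMost {m₁} {m₂} r P =
  ∀ (vs : List (Vtx m₁ m₂)) → Unique vs → All P vs → length vs ≤ r

IsProperLColoring : {m₁ m₂ : ℕ} → ListAssignment m₁ m₂ → (Vtx m₁ m₂ → Color) → Set
IsProperLColoring L f = (∀ v → f v ∈ L v) × (∀ u v → Adj u v → f u ≢ f v)

IsEquitableLColoring : {m₁ m₂ : ℕ} → ℕ → ListAssignment m₁ m₂ → (Vtx m₁ m₂ → Color) → Set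
IsEquitableLColoring {m₁} {m₂} k L f =
  IsProperLColoring L f ×
  (∀ c → InPalette L c → AtMost (ceilDiv (numV m₁ m₂) k) (λ v → f v ≡ c))

EquitablyLColorable : {m₁ m₂ : ℕ} → ℕ → ListAssignment m₁ m₂ → Set
EquitablyLColorable {m₁} {m₂} k L = ∃ λ (f : Vtx m₁ m₂ → Color) → IsEquitableLColoring k L f

-- The ε-greedy process.
-- A completed step t is a pair (c_t , C_t).  A history is stored as a list
-- of steps, MOST RECENT FIRST.

Step : ℕ → ℕ → Set
Step m₁ m₂ = Color × List (Vtx m₁ m₂)

usedColors : {m₁ m₂ : ℕ} → List (Step m₁ m₂) → List Color
usedColors = map proj₁

removedVs : {m₁ m₂ : ℕ} → List (Step m₁ m₂) → List (Vtx m₁ m₂)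
removedVs = concatMap proj₂

Eligible : {m₁ m₂ : ℕ} → ListAssignment m₁ m₂ → List (Step m₁ m₂) → Color → Vtx m₁ m₂ → Set
Eligible L hist c v = InAB v × v ∉ removedVs hist × c ∈ L v

LegalStep : {m₁ m₂ : ℕ} → ListAssignment m₁ m₂ → ℕ →
            List (Step m₁ m₂) → Color → List (Vtx m₁ m₂) → Set
LegalStep L ρ hist c C =
  InPalette L c × c ∉ usedColors hist ×
  Unique C × length C ≡ ρ × All (Eligible L hist c) C

data GreedySteps {m₁ m₂ : ℕ} (L : ListAssignment m₁ m₂) (ρ : ℕ) :
                 List (Step m₁ m₂) → Set where
  start : GreedySteps L ρ []
  step  : ∀ {hist c C} → GreedySteps L ρ hist → LegalStep L ρ hist c C →
          GreedySteps L ρ ((c , C) ∷ hist)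

IsGreedyRun : {m₁ m₂ : ℕ} → ℕ → ListAssignment m₁ m₂ → List (Step m₁ m₂) → Set
IsGreedyRun {m₁} {m₂} k L hist =
  GreedySteps L ρ hist × length hist ≤ k ∸ 2 ×
  (length hist ≡ k ∸ 2 ⊎
   ¬ (∃ λ c → InPalette L c × c ∉ usedColors hist × AtLeast ρ (Eligible L hist c)))
  where ρ = ceilDiv (numV m₁ m₂) k

InGε : {m₁ m₂ : ℕ} → List (Step m₁ m₂) → Vtx m₁ m₂ → Set
InGε hist v = v ∉ removedVs hist

InLε : {m₁ m₂ : ℕ} → ListAssignment m₁ m₂ → List (Step m₁ m₂) → Vtx m₁ m₂ → Color → Set
InLε L hist v c = c ∈ L v × c ∉ usedColors hist

InGεMinusCenters : {m₁ m₂ : ℕ} → List (Step m₁ m₂) → Vtx m₁ m₂ → Set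
InGεMinusCenters hist v = InGε hist v × v ≢ w₀ × v ≢ u₀

module Submission where

-- The ε-greedy run performs s ≤ k − 2 steps, so every list
-- L(v) keeps at least two colours outside {c₁,…,c_s}.  We colour every vertex
-- of G_ε with such a "fresh" colour: w₀ gets x, u₀ gets y ≠ x, each leaf in A
-- a fresh colour ≠ x and each leaf in B a fresh colour ≠ y; the removed
-- vertices keep their colour from g_ε.
-- It is equitable with ρ = ⌈|V(G)|/k⌉:
--   * the class of a used colour c_t is contained in C_t, of size ρ;
--   * the class of a fresh colour c consists of vertices of G_ε − {w₀,u₀}
--     whose list L_ε contains c (fewer than ρ of them, by hypothesis) together
--     with at most one centre (as x ≠ y), so it has at most ρ vertices.

open import Defs
open import Data.Nat using (ℕ; suc; _≤_; _≥_; _<_; _+_; _∸_; z≤n; s≤s)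
open import Data.Nat.Properties
  using (_≟_; ≤-trans; ≤-refl; <⇒≤; <⇒≱; ≰⇒>; m≤n⇒m⊓n≡m; m+[n∸m]≡n; +-monoʳ-≤; module ≤-Reasoning)
open import Data.Bool using (Bool; true; false)
import Data.Bool.Properties as Bool
open import Data.Fin using (Fin)
import Data.Fin.Properties as Fin
open import Data.Sum using (_⊎_; inj₁; inj₂; map₂)
import Data.Sum.Properties as Sum
open import Data.Product using (∃; _×_; _,_; proj₁; proj₂)
open import Data.List using (List; []; _∷_; length; take)
open import Data.List.Properties using (length-take; length-map)
open import Data.List.Membership.Propositional using (_∈_; _∉_; find)
open import Data.List.Membership.Propositional.Properties using (∈-++⁺ˡ; ∈-++⁺ʳ; ∈-++⁻)
import Data.List.Membership.DecPropositional as DecMembership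
open import Data.List.Relation.Unary.Any using (here; there)
open import Data.List.Relation.Unary.All as All using (All; []; _∷_; all?)
open import Data.List.Relation.Unary.All.Properties using (¬All⇒Any¬; take⁺)
open import Data.List.Relation.Unary.Unique.Propositional using (Unique)
import Data.List.Relation.Unary.Unique.Propositional.Properties as Unique
open import Data.List.Relation.Unary.AllPairs using ([]; _∷_)
open import Relation.Binary.Definitions using (DecidableEquality)
open import Relation.Binary.PropositionalEquality
open import Relation.Nullary using (¬_; Dec; yes; no; contradiction)
open import Relation.Nullary.Decidable using (map′)
open import Function using (_∘_; case_of_)

module _ {A : Set} where

  delete : ∀ {x : A} {ys} → x ∈ ys → List A
  delete {ys = _ ∷ ys} (here _)  = ys
  delete {ys = y ∷ _}  (there p) = y ∷ delete p

  length-delete : ∀ {x : A} {ys} (p : x ∈ ys) → length ys ≡ suc (length (delete p))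
  length-delete (here _)  = refl
  length-delete (there p) = cong suc (length-delete p)

  ∈-delete : ∀ {x z : A} {ys} (p : x ∈ ys) → z ∈ ys → z ≢ x → z ∈ delete p
  ∈-delete (here refl) (here refl) z≢x = contradiction refl z≢x
  ∈-delete (here refl) (there q)   z≢x = q
  ∈-delete (there p)   (here refl) z≢x = here refl
  ∈-delete (there p)   (there q)   z≢x = there (∈-delete p q z≢x)

  unique-⊆-length : ∀ {xs ys : List A} → Unique xs → All (_∈ ys) xs → length xs ≤ length ys
  unique-⊆-length [] [] = z≤n
  unique-⊆-length {x ∷ xs} {ys} (x∉xs ∷ uxs) (x∈ys ∷ xs⊆ys)
    rewrite length-delete x∈ys = s≤s (unique-⊆-length uxs (All.zipWith shift (x∉xs , xs⊆ys)))
    where shift : ∀ {z} → x ≢ z × z ∈ ys → z ∈ delete x∈ys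
          shift (x≢z , z∈ys) = ∈-delete x∈ys z∈ys (λ z≡x → x≢z (sym z≡x))

  module _ (_≟A_ : DecidableEquality A) where
    open DecMembership _≟A_ using (_∈?_)

    outside : ∀ (xs ys : List A) → Unique xs → length ys < length xs → ∃ λ z → z ∈ xs × z ∉ ys
    outside xs ys uxs ys<xs with all? (_∈? ys) xs
    ... | yes xs⊆ys = contradiction (unique-⊆-length uxs xs⊆ys) (<⇒≱ ys<xs)
    ... | no  xs⊈ys = find (¬All⇒Any¬ (_∈? ys) xs xs⊈ys)

  exactly : ∀ {P : A → Set} r (xs : List A) → Unique xs → All P xs → r ≤ length xs →
            ∃ λ (ys : List A) → Unique ys × length ys ≡ r × All P ys
  exactly r xs uxs pxs r≤|xs| =
    take r xs , Unique.take⁺ r uxs , trans (length-take r xs) (m≤n⇒m⊓n≡m r≤|xs|) , take⁺ r pxs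

  dropPoint : ∀ {P : A → Set} (z : A) (xs : List A) → Unique xs → All (λ v → P v ⊎ v ≡ z) xs →
              ∃ λ (ys : List A) → Unique ys × All P ys × length xs ≤ suc (length ys) × All (_∈ xs) ys
  dropPoint z [] [] [] = [] , [] , [] , z≤n , []
  dropPoint {P} z (x ∷ xs) (x∉xs ∷ uxs) (inj₂ refl ∷ rest) =
    xs , uxs , All.zipWith notZ (x∉xs , rest) , ≤-refl , All.tabulate there
    where notZ : ∀ {v} → x ≢ v × (P v ⊎ v ≡ x) → P v
          notZ (_   , inj₁ pv)   = pv
          notZ (x≢v , inj₂ v≡x) = contradiction (sym v≡x) x≢v
  dropPoint z (x ∷ xs) (x∉xs ∷ uxs) (inj₁ px ∷ rest) with dropPoint z xs uxs rest
  ... | ys , uys , pys , le , ys⊆xs =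
    x ∷ ys , All.map (All.lookup x∉xs) ys⊆xs ∷ uys , px ∷ pys , s≤s le , here refl ∷ All.map there ys⊆xs

module _ {m₁ m₂ : ℕ} where

  private
    Code : Set
    Code = Bool ⊎ (Fin m₁ ⊎ Fin m₂)

    code : Vtx m₁ m₂ → Code
    code w₀    = inj₁ true
    code u₀    = inj₁ false
    code (a i) = inj₂ (inj₁ i)
    code (b j) = inj₂ (inj₂ j)

    decode : Code → Vtx m₁ m₂
    decode (inj₁ true)      = w₀
    decode (inj₁ false)     = u₀
    decode (inj₂ (inj₁ i))  = a i
    decode (inj₂ (inj₂ j))  = b j

    decode-code : ∀ v → decode (code v) ≡ v
    decode-code w₀    = refl
    decode-code u₀    = refl
    decode-code (a i) = refl
    decode-code (b j) = refl

    code-injective : ∀ {u v} → code u ≡ code v → u ≡ v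
    code-injective {u} {v} eq =
      trans (sym (decode-code u)) (trans (cong decode eq) (decode-code v))

  _≟V_ : DecidableEquality (Vtx m₁ m₂)
  u ≟V v = map′ code-injective (cong code)
                (Sum.≡-dec Bool._≟_ (Sum.≡-dec Fin._≟_ Fin._≟_) (code u) (code v))

open DecMembership _≟_ using () renaming (_∈?_ to _∈ℕ?_)

_∈V?_ : ∀ {m₁ m₂} (v : Vtx m₁ m₂) (vs : List (Vtx m₁ m₂)) → Dec (v ∈ vs)
_∈V?_ = DecMembership._∈?_ _≟V_

module _ {m₁ m₂ : ℕ} where

  -- The partial colouring g_ε of a run, extended by a default colouring d: a
  -- vertex of some C_t receives c_t, every other vertex v receives d v.
  extend : List (Step m₁ m₂) → (Vtx m₁ m₂ → Color) → Vtx m₁ m₂ → Color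
  extend []            d v = d v
  extend ((c , C) ∷ h) d v with v ∈V? C
  ... | yes _ = c
  ... | no  _ = extend h d v

  extend-kept : ∀ h d v → v ∉ removedVs h → extend h d v ≡ d v
  extend-kept []            d v v∉ = refl
  extend-kept ((c , C) ∷ h) d v v∉ with v ∈V? C
  ... | yes v∈C = contradiction (∈-++⁺ˡ v∈C) v∉
  ... | no  _   = extend-kept h d v (λ v∈ → v∉ (∈-++⁺ʳ C v∈))

  extend-removed : ∀ h d v → v ∈ removedVs h → extend h d v ∈ usedColors h
  extend-removed ((c , C) ∷ h) d v v∈ with v ∈V? C
  ... | yes _   = here refl
  ... | no  v∉C with ∈-++⁻ C v∈
  ...   | inj₁ v∈C = contradiction v∈C v∉C
  ...   | inj₂ v∈h = there (extend-removed h d v v∈h)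

  extend-default-or-used : ∀ h d v → extend h d v ≡ d v ⊎ extend h d v ∈ usedColors h
  extend-default-or-used []            d v = inj₁ refl
  extend-default-or-used ((c , C) ∷ h) d v with v ∈V? C
  ... | yes _ = inj₂ (here refl)
  ... | no  _ = map₂ there (extend-default-or-used h d v)

  module _ (L : ListAssignment m₁ m₂) (ρ : ℕ) where

    removed-InAB : ∀ {h} → GreedySteps L ρ h → ∀ v → v ∈ removedVs h → InAB v
    removed-InAB (step {C = C} run (_ , _ , _ , _ , eligible)) v v∈ with ∈-++⁻ C v∈
    ... | inj₁ v∈C = proj₁ (All.lookup eligible v∈C)
    ... | inj₂ v∈h = removed-InAB run v v∈h

    extend-∈L : ∀ {h} → GreedySteps L ρ h → ∀ d v → v ∈ removedVs h → extend h d v ∈ L v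
    extend-∈L (step {C = C} run (_ , _ , _ , _ , eligible)) d v v∈ with v ∈V? C
    ... | yes v∈C = proj₂ (proj₂ (All.lookup eligible v∈C))
    ... | no  v∉C with ∈-++⁻ C v∈
    ...   | inj₁ v∈C = contradiction v∈C v∉C
    ...   | inj₂ v∈h = extend-∈L run d v v∈h

    usedClass-⊆ : ∀ {h} → GreedySteps L ρ h → ∀ d → (∀ v → d v ∉ usedColors h) →
                  ∀ c → c ∈ usedColors h →
                  ∃ λ C → Unique C × length C ≡ ρ × (∀ v → extend h d v ≡ c → v ∈ C)
    usedClass-⊆ (step {h} {c′} {C′} run (_ , c′∉h , uC′ , |C′| , _)) d fresh c (here refl) =
      C′ , uC′ , |C′| , inC′
      where inC′ : ∀ v → extend ((c′ , C′) ∷ h) d v ≡ c′ → v ∈ C′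
            inC′ v eq with v ∈V? C′
            ... | yes v∈C′ = v∈C′
            ... | no  _ with extend-default-or-used h d v
            ...   | inj₁ dflt = contradiction (here (trans (sym dflt) eq)) (fresh v)
            ...   | inj₂ used = contradiction (subst (_∈ usedColors h) eq used) c′∉h
    usedClass-⊆ (step {h} {c′} {C′} run (_ , c′∉h , _ , _ , _)) d fresh c (there c∈h)
      with usedClass-⊆ run d (λ v d∈h → fresh v (there d∈h)) c c∈h
    ... | C , uC , |C| , inC = C , uC , |C| , inC′
      where inC′ : ∀ v → extend ((c′ , C′) ∷ h) d v ≡ c → v ∈ C
            inC′ v eq with v ∈V? C′
            ... | yes _ = contradiction (subst (_∈ usedColors h) (sym eq) c∈h) c′∉h
            ... | no  _ = inC v eq

    usedClass-atMost : ∀ {h} → GreedySteps L ρ h → ∀ d → (∀ v → d v ∉ usedColors h) →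
                       ∀ c → c ∈ usedColors h → AtMost ρ (λ v → extend h d v ≡ c)
    usedClass-atMost run d fresh c c∈h vs uvs class with usedClass-⊆ run d fresh c c∈h
    ... | C , _ , |C| , inC =
      subst (length vs ≤_) |C| (unique-⊆-length uvs (All.map (λ {v} → inC v) class))

module Colouring {m₁ m₂ : ℕ} (L : ListAssignment m₁ m₂) (ρ : ℕ)
                 (hist : List (Step m₁ m₂)) (run : GreedySteps L ρ hist)
                 (L-unique : ∀ v → Unique (L v))
                 (room : ∀ v → 2 + length (usedColors hist) ≤ length (L v)) where

  used : List Color
  used = usedColors hist

  spare : ∀ v z → ∃ λ c → c ∈ L v × c ∉ z ∷ used
  spare v z = outside _≟_ (L v) (z ∷ used) (L-unique v) (room v)

  spare-w₀ : ∃ λ c → c ∈ L w₀ × c ∉ used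
  spare-w₀ = outside _≟_ (L w₀) used (L-unique w₀) (<⇒≤ (room w₀))

  x : Color
  x = proj₁ spare-w₀

  y : Color
  y = proj₁ (spare u₀ x)

  x≢y : x ≢ y
  x≢y x≡y = proj₂ (proj₂ (spare u₀ x)) (here (sym x≡y))

  default : Vtx m₁ m₂ → Color
  default w₀    = x
  default u₀    = y
  default (a i) = proj₁ (spare (a i) x)
  default (b j) = proj₁ (spare (b j) y)

  default-∈L : ∀ v → default v ∈ L v
  default-∈L w₀    = proj₁ (proj₂ spare-w₀)
  default-∈L u₀    = proj₁ (proj₂ (spare u₀ x))
  default-∈L (a i) = proj₁ (proj₂ (spare (a i) x))
  default-∈L (b j) = proj₁ (proj₂ (spare (b j) y))

  default-fresh : ∀ v → default v ∉ used
  default-fresh w₀    = proj₂ (proj₂ spare-w₀)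
  default-fresh u₀    = proj₂ (proj₂ (spare u₀ x)) ∘ there
  default-fresh (a i) = proj₂ (proj₂ (spare (a i) x)) ∘ there
  default-fresh (b j) = proj₂ (proj₂ (spare (b j) y)) ∘ there

  colouring : Vtx m₁ m₂ → Color
  colouring = extend hist default

  colouring-∈L : ∀ v → colouring v ∈ L v
  colouring-∈L v with v ∈V? removedVs hist
  ... | yes v∈ = extend-∈L L ρ run default v v∈
  ... | no  v∉ = subst (_∈ L v) (sym (extend-kept hist default v v∉)) (default-∈L v)

  -- The centres are never removed, so they keep x and y.
  colouring-w₀ : colouring w₀ ≡ x
  colouring-w₀ = extend-kept hist default w₀ (λ w₀∈ → case removed-InAB L ρ run w₀ w₀∈ of λ ())

  colouring-u₀ : colouring u₀ ≡ y
  colouring-u₀ = extend-kept hist default u₀ (λ u₀∈ → case removed-InAB L ρ run u₀ u₀∈ of λ ())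

  colouring-avoids : ∀ v z → z ∉ used → default v ≢ z → colouring v ≢ z
  colouring-avoids v z z∉ d≢z eq with extend-default-or-used hist default v
  ... | inj₁ dflt = d≢z (trans (sym dflt) eq)
  ... | inj₂ u    = z∉ (subst (_∈ used) eq u)

  leaf-a≢x : ∀ i → colouring (a i) ≢ x
  leaf-a≢x i = colouring-avoids (a i) x (default-fresh w₀) (proj₂ (proj₂ (spare (a i) x)) ∘ here)

  leaf-b≢y : ∀ j → colouring (b j) ≢ y
  leaf-b≢y j = colouring-avoids (b j) y (default-fresh u₀) (proj₂ (proj₂ (spare (b j) y)) ∘ here)

  colouring-proper : ∀ u v → Adj u v → colouring u ≢ colouring v
  colouring-proper _ _ (w-a i) eq = leaf-a≢x i (trans (sym eq) colouring-w₀)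
  colouring-proper _ _ (a-w i) eq = leaf-a≢x i (trans eq colouring-w₀)
  colouring-proper _ _ (u-b j) eq = leaf-b≢y j (trans (sym eq) colouring-u₀)
  colouring-proper _ _ (b-u j) eq = leaf-b≢y j (trans eq colouring-u₀)

  Candidate : Color → Vtx m₁ m₂ → Set
  Candidate c v = InGεMinusCenters hist v × InLε L hist v c

  freshLeaf : ∀ c → c ∉ used → ∀ v → InAB v → colouring v ≡ c → Candidate c v
  freshLeaf c c∉ v ab eq = (kept , notW₀ ab , notU₀ ab) , subst (_∈ L v) eq (colouring-∈L v) , c∉
    where kept : v ∉ removedVs hist
          kept v∈ = c∉ (subst (_∈ used) eq (extend-removed hist default v v∈))
          notW₀ : ∀ {v} → InAB v → v ≢ w₀
          notW₀ (inA i) ()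
          notW₀ (inB j) ()
          notU₀ : ∀ {v} → InAB v → v ≢ u₀
          notU₀ (inA i) ()
          notU₀ (inB j) ()

  -- The class of a fresh colour consists of candidates and at most one centre,
  -- because the centres have the distinct colours x and y.
  freshClass : ∀ c → c ∉ used → ∃ λ z → ∀ {v} → colouring v ≡ c → Candidate c v ⊎ v ≡ z
  freshClass c c∉ with c ≟ x
  ... | yes c≡x = w₀ , member
    where member : ∀ {v} → colouring v ≡ c → Candidate c v ⊎ v ≡ w₀
          member {w₀}  eq = inj₂ refl
          member {u₀}  eq = contradiction (trans (sym colouring-u₀) (trans eq c≡x)) (x≢y ∘ sym)
          member {a i} eq = inj₁ (freshLeaf c c∉ (a i) (inA i) eq)
          member {b j} eq = inj₁ (freshLeaf c c∉ (b j) (inB j) eq)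
  ... | no  c≢x = u₀ , member
    where member : ∀ {v} → colouring v ≡ c → Candidate c v ⊎ v ≡ u₀
          member {w₀}  eq = contradiction (trans (sym eq) colouring-w₀) c≢x
          member {u₀}  eq = inj₂ refl
          member {a i} eq = inj₁ (freshLeaf c c∉ (a i) (inA i) eq)
          member {b j} eq = inj₁ (freshLeaf c c∉ (b j) (inB j) eq)

  colouring-equitable : ¬ (∃ λ c → AtLeast ρ (Candidate c)) →
                        ∀ c → AtMost ρ (λ v → colouring v ≡ c)
  colouring-equitable few c with c ∈ℕ? used
  ... | yes c∈ = usedClass-atMost L ρ run default default-fresh c c∈
  ... | no  c∉ = λ vs uvs class →
    let (z , member)               = freshClass c c∉
        (ps , ups , cand , le , _) = dropPoint z vs uvs (All.map member class)
        ps<ρ = ≰⇒> (λ ρ≤ps → few (c , exactly ρ ps ups cand ρ≤ps))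
    in ≤-trans le ps<ρ

lemma4p3 : (k m₁ m₂ : ℕ) → k ≥ 3 →
    (L : ListAssignment m₁ m₂) → IsKAssignment k L →
    (hist : List (Step m₁ m₂)) → IsGreedyRun k L hist →
    ¬ (∃ λ c → AtLeast (ceilDiv (numV m₁ m₂) k)
                 (λ v → InGεMinusCenters hist v × InLε L hist v c)) →
    EquitablyLColorable k L
lemma4p3 k m₁ m₂ k≥3 L isK hist (run , s≤k∸2 , _) few =
  colouring , (colouring-∈L , colouring-proper) , λ c _ → colouring-equitable few c
  where
    room : ∀ v → 2 + length (usedColors hist) ≤ length (L v)
    room v = begin
      2 + length (usedColors hist) ≡⟨ cong (2 +_) (length-map proj₁ hist) ⟩
      2 + length hist              ≤⟨ +-monoʳ-≤ 2 s≤k∸2 ⟩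
      2 + (k ∸ 2)                  ≡⟨ m+[n∸m]≡n (<⇒≤ k≥3) ⟩
      k                            ≡⟨ sym (proj₂ (isK v)) ⟩
      length (L v)                 ∎
      where open ≤-Reasoning

    open Colouring L (ceilDiv (numV m₁ m₂) k) hist run (proj₁ ∘ isK) room
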